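{- Let $2 \le D \le N$ be integers and $\alpha\in(0,1)$. Then \[ f_D(N,\alpha) \ge \frac{\alpha^2 N^2}{N + D} - \frac{\alpha N + 1}{D}. \] In particular, if $\alpha = \alpha(N)$ and $D = D(N)$ (with $2\le D\le N$) are such that $D\alpha \to \infty$ as $N \to \infty$, then $f_D(N,\alpha) \ge (1+o(1))\alpha^2 N$ as $N\to\infty$.
   Context: For a positive integer $N$, $[N] := \{1,2,\dots,N\}$. For a finite set $A$ of integers and an integer $d$, $r_{A-A}(d) := \#\{(a,a') \in A\times A : d = a - a'\}$. For $D > 1$, $M_D(A) := \max_{1 \le d < D} r_{A-A}(d)$. For positive integers $D \le N$ and $\alpha\in(0,1)$, $f_D(N,\alpha) := \min\{ M_D(A) : A \subseteq [N],\ |A| \ge \alpha N\}$.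
   Formalization: The parameter α and, in the asymptotic part, the values of α(N) range over the rationals in (0,1). -}

module Defs where

open import Data.Nat as ℕ using (ℕ; zero; suc; _+_; _⊔_; _⊓_)
open import Data.Integer using (+_)
open import Data.Rational as ℚ using (ℚ; _/_; _≤ᵇ_)
open import Data.Fin using (Fin; toℕ)
open import Data.Fin.Subset using (Subset; ⊤; ∣_∣; inside; outside)
open import Data.Fin.Subset.Properties using (_∈?_)
open import Data.List using (List; []; _∷_; map; filter; foldr; length; allFin; concatMap; upTo)
open import Data.Vec using (_∷_; [])
open import Data.Product using (_×_; _,_)
open import Relation.Binary.PropositionalEquality using (_≡_)

ℕ→ℚ : ℕ → ℚ
ℕ→ℚ n = + n / 1

-- Reciprocal of a natural number as a rational, 1/n; it is only ever applied to
-- n ≥ 2 below, the value at 0 is an irrelevant convention.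
recip : ℕ → ℚ
recip zero    = ℚ.0ℚ
recip (suc n) = + 1 / suc n

-- A subset A ⊆ [N] is represented by p : Subset N (= Vec Bool N); the index
-- i : Fin N stands for the integer toℕ i + 1 ∈ [N].

val : {N : ℕ} → Fin N → ℕ
val i = suc (toℕ i)

members : {N : ℕ} → Subset N → List (Fin N)
members {N} p = filter (λ i → i ∈? p) (allFin N)

pairs : {N : ℕ} → Subset N → List (ℕ × ℕ)
pairs p = concatMap (λ a → map (λ a' → val a , val a') (members p)) (members p)

r : {N : ℕ} → Subset N → ℕ → ℕ
r p d = length (filter (λ { (a , a') → a ℕ.≟ a' + d }) (pairs p))

-- M_D(A) = max_{1 ≤ d < D} r_{A-A}(d)  (upTo k = [0, …, k-1], so d = suc k ranges
-- over 1, …, D-1; for D ≥ 2 the range is nonempty and the fold is the true max).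
M : ℕ → {N : ℕ} → Subset N → ℕ
M D p = foldr _⊔_ 0 (map (λ k → r p (suc k)) (upTo (D ℕ.∸ 1)))

allSubsets : (N : ℕ) → List (Subset N)
allSubsets zero    = [] ∷ []
allSubsets (suc N) = concatMap (λ p → (inside ∷ p) ∷ (outside ∷ p) ∷ []) (allSubsets N)

-- The minimum is taken as a fold of _⊓_ over all admissible subsets, starting from
-- M_D([N]); for α ≤ 1 the full set [N] is itself admissible, so this is exactly
-- the minimum over the (nonempty) admissible family.
f : ℕ → ℕ → ℚ → ℕ
f D N α = foldr _⊓_ (M D {N} ⊤)
  (map (M D) (filter (λ p → (α ℚ.* ℕ→ℚ N) ℚ.≤? ℕ→ℚ ∣ p ∣) (allSubsets N)))

module Submission where

-- Let A ⊆ [N], k = |A|, M = M_D(A), and let v be the indicator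
-- of A shifted right by D − 1 places, living in [0, L) with L = N + D.  The
-- D windows v(x) + ⋯ + v(x + D − 1), x < L, have total sum D k, while the sum
-- of their squares is at most D k + D (D − 1) M, since a cross term v(x)v(x + d)
-- with 1 ≤ d < D sums to r_{A−A}(d) ≤ M.  Cauchy–Schwarz gives
--   D² k² ≤ L (D k + D (D − 1) M),  i.e.  D k² ≤ L k + L M (D − 1),
-- which, read at x = αN ≤ k, is the main inequality.  For the asymptotic
-- statement fix ε and a scale c with cε ≥ 3; once Dα ≥ c(c + 2), choose a lag
-- D′ ≤ D with αD′ ∈ [c, c + 2], use f_D ≥ f_{D′} and the main inequality for D′.

module RationalFacts where

  open import Defs
  open import Data.Nat as ℕ using (ℕ; zero; suc)
  import Data.Nat.Coprimality as C
  open import Data.Integer as ℤ using (+_)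
  import Data.Integer.Properties as ℤP
  open import Data.Rational
  open import Data.Rational.Properties
  import Data.Rational.Unnormalised as U
  import Data.Rational.Unnormalised.Properties as UP
  open import Data.Rational.Solver using (module +-*-Solver)
  open +-*-Solver
  open import Relation.Binary.PropositionalEquality
  open import Relation.Nullary using (yes; no)

  toℚᵘ-ℕ→ℚ : ∀ n → toℚᵘ (ℕ→ℚ n) U.≃ U.mkℚᵘ (+ n) 0
  toℚᵘ-ℕ→ℚ n = toℚᵘ-fromℚᵘ (U.mkℚᵘ (+ n) 0)

  ℕ→ℚ-+ : ∀ m n → ℕ→ℚ (m ℕ.+ n) ≡ ℕ→ℚ m + ℕ→ℚ n
  ℕ→ℚ-+ m n = toℚᵘ-injective (begin
    toℚᵘ (ℕ→ℚ (m ℕ.+ n))              ≈⟨ toℚᵘ-ℕ→ℚ (m ℕ.+ n) ⟩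
    U.mkℚᵘ (+ (m ℕ.+ n)) 0             ≈⟨ U.*≡* numerators ⟩
    U.mkℚᵘ (+ m) 0 U.+ U.mkℚᵘ (+ n) 0  ≈⟨ UP.+-cong (toℚᵘ-ℕ→ℚ m) (toℚᵘ-ℕ→ℚ n) ⟨
    toℚᵘ (ℕ→ℚ m) U.+ toℚᵘ (ℕ→ℚ n)      ≈⟨ toℚᵘ-homo-+ (ℕ→ℚ m) (ℕ→ℚ n) ⟨
    toℚᵘ (ℕ→ℚ m + ℕ→ℚ n)               ∎)
    where
    open UP.≃-Reasoning
    numerators : + (m ℕ.+ n) ℤ.* + 1 ≡ (+ m ℤ.* + 1 ℤ.+ + n ℤ.* + 1) ℤ.* + 1
    numerators rewrite ℤP.*-identityʳ (+ m) | ℤP.*-identityʳ (+ n) =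
      cong (ℤ._* + 1) (ℤP.pos-+ m n)

  ℕ→ℚ-* : ∀ m n → ℕ→ℚ (m ℕ.* n) ≡ ℕ→ℚ m * ℕ→ℚ n
  ℕ→ℚ-* m n = toℚᵘ-injective (begin
    toℚᵘ (ℕ→ℚ (m ℕ.* n))              ≈⟨ toℚᵘ-ℕ→ℚ (m ℕ.* n) ⟩
    U.mkℚᵘ (+ (m ℕ.* n)) 0             ≈⟨ U.*≡* (cong (ℤ._* + 1) (ℤP.pos-* m n)) ⟩
    U.mkℚᵘ (+ m) 0 U.* U.mkℚᵘ (+ n) 0  ≈⟨ UP.*-cong (toℚᵘ-ℕ→ℚ m) (toℚᵘ-ℕ→ℚ n) ⟨
    toℚᵘ (ℕ→ℚ m) U.* toℚᵘ (ℕ→ℚ n)      ≈⟨ toℚᵘ-homo-* (ℕ→ℚ m) (ℕ→ℚ n) ⟨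
    toℚᵘ (ℕ→ℚ m * ℕ→ℚ n)               ∎)
    where open UP.≃-Reasoning

  ℕ→ℚ-mono-≤ : ∀ {m n} → m ℕ.≤ n → ℕ→ℚ m ≤ ℕ→ℚ n
  ℕ→ℚ-mono-≤ {m} {n} m≤n = toℚᵘ-cancel-≤ (begin
    toℚᵘ (ℕ→ℚ m)    ≃⟨ toℚᵘ-ℕ→ℚ m ⟩
    U.mkℚᵘ (+ m) 0  ≤⟨ U.*≤* (ℤP.*-monoʳ-≤-nonNeg (+ 1) (ℤ.+≤+ m≤n)) ⟩
    U.mkℚᵘ (+ n) 0  ≃⟨ toℚᵘ-ℕ→ℚ n ⟨
    toℚᵘ (ℕ→ℚ n)    ∎)
    where open UP.≤-Reasoning

  ℕ→ℚ-nonNeg : ∀ n → 0ℚ ≤ ℕ→ℚ n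
  ℕ→ℚ-nonNeg n = ℕ→ℚ-mono-≤ (ℕ.z≤n {n})

  ℕ→ℚ-pos : ∀ n → 0ℚ < ℕ→ℚ (suc n)
  ℕ→ℚ-pos n = <-≤-trans (positive⁻¹ 1ℚ) (ℕ→ℚ-mono-≤ (ℕ.s≤s (ℕ.z≤n {n})))

  ℕ→ℚ*recip : ∀ n → ℕ→ℚ (suc n) * recip (suc n) ≡ 1ℚ
  ℕ→ℚ*recip n = toℚᵘ-injective (begin
    toℚᵘ (ℕ→ℚ (suc n) * recip (suc n))          ≈⟨ toℚᵘ-homo-* (ℕ→ℚ (suc n)) (recip (suc n)) ⟩
    toℚᵘ (ℕ→ℚ (suc n)) U.* toℚᵘ (recip (suc n)) ≈⟨ UP.*-cong (toℚᵘ-ℕ→ℚ (suc n)) (toℚᵘ-fromℚᵘ (U.mkℚᵘ (+ 1) n)) ⟩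
    U.mkℚᵘ (+ suc n) 0 U.* U.mkℚᵘ (+ 1) n       ≈⟨ UP.*-inverseʳ (U.mkℚᵘ (+ suc n) 0) ⟩
    U.1ℚᵘ                                        ∎)
    where
    open UP.≃-Reasoning

  recip-nonNeg : ∀ n → 0ℚ ≤ recip n
  recip-nonNeg zero    = ≤-refl
  recip-nonNeg (suc n) = toℚᵘ-cancel-≤ (UP.≤-respʳ-≃ (UP.≃-sym (toℚᵘ-fromℚᵘ (U.mkℚᵘ (+ 1) n))) (U.*≤* (ℤ.+≤+ ℕ.z≤n)))

  times-denominator : ∀ a b .(cop : C.Coprime a (suc b)) → mkℚ (+ a) b cop * ℕ→ℚ (suc b) ≡ ℕ→ℚ a
  times-denominator a b cop = toℚᵘ-injective (begin
    toℚᵘ (mkℚ (+ a) b cop * ℕ→ℚ (suc b))   ≈⟨ toℚᵘ-homo-* (mkℚ (+ a) b cop) (ℕ→ℚ (suc b)) ⟩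
    U.mkℚᵘ (+ a) b U.* toℚᵘ (ℕ→ℚ (suc b))  ≈⟨ UP.*-congˡ {U.mkℚᵘ (+ a) b} (toℚᵘ-ℕ→ℚ (suc b)) ⟩
    U.mkℚᵘ (+ a) b U.* U.mkℚᵘ (+ suc b) 0  ≈⟨ U.*≡* (ℤP.*-assoc (+ a) (+ suc b) (+ 1)) ⟩
    U.mkℚᵘ (+ a) 0                          ≈⟨ toℚᵘ-ℕ→ℚ a ⟨
    toℚᵘ (ℕ→ℚ a)                            ∎)
    where open UP.≃-Reasoning

  ≤-from-gap : ∀ {p q} r → q - p ≡ r → 0ℚ ≤ r → p ≤ q
  ≤-from-gap {p} {q} r gap 0≤r = subst₂ _≤_ (+-identityˡ p) q-p+p≡q (+-monoˡ-≤ p (subst (0ℚ ≤_) (sym gap) 0≤r))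
    where
    q-p+p≡q : q - p + p ≡ q
    q-p+p≡q = solve 2 (λ q p → (q :- p) :+ p := q) refl q p

  gap-nonNeg : ∀ {p q} → p ≤ q → 0ℚ ≤ q - p
  gap-nonNeg {p} {q} p≤q = subst (_≤ q - p) (+-inverseʳ p) (+-monoˡ-≤ (- p) p≤q)

  *-nonNeg : ∀ {p q} → 0ℚ ≤ p → 0ℚ ≤ q → 0ℚ ≤ p * q
  *-nonNeg {p} {q} 0≤p 0≤q = nonNegative⁻¹ (p * q) {{nonNeg*nonNeg⇒nonNeg p {{nonNegative 0≤p}} q {{nonNegative 0≤q}}}}

  *-pos : ∀ {p q} → 0ℚ < p → 0ℚ < q → 0ℚ < p * q
  *-pos {p} {q} 0<p 0<q = positive⁻¹ (p * q) {{pos*pos⇒pos p {{positive 0<p}} q {{positive 0<q}}}}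

  mulˡ-≤ : ∀ z {p q} → 0ℚ ≤ z → p ≤ q → z * p ≤ z * q
  mulˡ-≤ z 0≤z = *-monoˡ-≤-nonNeg z {{nonNegative 0≤z}}

  mulʳ-≤ : ∀ z {p q} → 0ℚ ≤ z → p ≤ q → p * z ≤ q * z
  mulʳ-≤ z 0≤z = *-monoʳ-≤-nonNeg z {{nonNegative 0≤z}}

  cancel-mulˡ-≤ : ∀ z {p q} → 0ℚ < z → z * p ≤ z * q → p ≤ q
  cancel-mulˡ-≤ z 0<z = *-cancelˡ-≤-pos z {{positive 0<z}}

  cancel-mulʳ-≤ : ∀ z {p q} → 0ℚ < z → p * z ≤ q * z → p ≤ q
  cancel-mulʳ-≤ z 0<z = *-cancelʳ-≤-pos z {{positive 0<z}}

  -- On [0, k] the quadratic t ↦ D t² − L t (with D ≥ 0) stays below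
  -- max(0, D k² − L k): it is ≤ 0 while t D ≤ L and increasing afterwards.
  quadratic-≤ : ∀ {x k D L E} → 0ℚ ≤ x → x ≤ k → 0ℚ ≤ D → 0ℚ ≤ E →
                D * k * k - L * k ≤ E → D * x * x - L * x ≤ E
  quadratic-≤ {x} {k} {D} {L} {E} 0≤x x≤k 0≤D 0≤E atK with x * D ≤? L
  ... | yes xD≤L = ≤-trans (≤-from-gap (x * (L - x * D)) gap (*-nonNeg 0≤x (gap-nonNeg xD≤L))) 0≤E
    where
    gap : 0ℚ - (D * x * x - L * x) ≡ x * (L - x * D)
    gap = solve 3 (λ x D L → con 0ℚ :- (D :* x :* x :- L :* x) := x :* (L :- x :* D)) refl x D L
  ... | no  xD≰L = ≤-trans (≤-from-gap ((k - x) * (D * k + (x * D - L))) gap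
                             (*-nonNeg (gap-nonNeg x≤k) (+-mono-≤ (*-nonNeg 0≤D (≤-trans 0≤x x≤k)) (gap-nonNeg (<⇒≤ (≰⇒> xD≰L))))))
                           atK
    where
    gap : (D * k * k - L * k) - (D * x * x - L * x) ≡ (k - x) * (D * k + (x * D - L))
    gap = solve 4 (λ x k D L → (D :* k :* k :- L :* k) :- (D :* x :* x :- L :* x) := (k :- x) :* (D :* k :+ (x :* D :- L))) refl x k D L


module RationalReading where

  open import Defs
  open RationalFacts
  open import Data.Nat as ℕ using (ℕ; suc)
  import Data.Nat.Properties as ℕP
  open import Data.Rational
  open import Data.Rational.Properties
  open import Data.Rational.Solver using (module +-*-Solver)
  open +-*-Solver
  open import Relation.Binary.PropositionalEquality

  rational-reading : (x : ℚ) (k M L₁ D₁ : ℕ) → 0ℚ ≤ x → x ≤ ℕ→ℚ k →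
    suc D₁ ℕ.* k ℕ.* k ℕ.≤ suc L₁ ℕ.* k ℕ.+ suc L₁ ℕ.* M ℕ.* D₁ →
    x * x * recip (suc L₁) - (x + 1ℚ) * recip (suc D₁) ≤ ℕ→ℚ M
  rational-reading x k M L₁ D₁ 0≤x x≤k counting = begin
    x * x * rL - (x + 1ℚ) * rD                ≡⟨ scale-left ⟨
    (D * x * x - L * x - L) * (rL * rD)       ≤⟨ mulʳ-≤ (rL * rD) (*-nonNeg (recip-nonNeg (suc L₁)) (recip-nonNeg (suc D₁))) at-x ⟩
    L * Mq * D * (rL * rD)                    ≡⟨ scale-right ⟩
    Mq                                        ∎
    where
    open ≤-Reasoning
    D = ℕ→ℚ (suc D₁)
    L = ℕ→ℚ (suc L₁)
    Mq = ℕ→ℚ M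
    rD = recip (suc D₁)
    rL = recip (suc L₁)
    0≤LM : 0ℚ ≤ L * Mq
    0≤LM = *-nonNeg (ℕ→ℚ-nonNeg (suc L₁)) (ℕ→ℚ-nonNeg M)
    K = ℕ→ℚ k
    counting-ℚ : D * K * K ≤ L * K + L * Mq * ℕ→ℚ D₁
    counting-ℚ = subst₂ _≤_
      (trans (ℕ→ℚ-* (suc D₁ ℕ.* k) k) (cong (_* K) (ℕ→ℚ-* (suc D₁) k)))
      (trans (ℕ→ℚ-+ (suc L₁ ℕ.* k) _) (cong₂ _+_ (ℕ→ℚ-* (suc L₁) k)
        (trans (ℕ→ℚ-* (suc L₁ ℕ.* M) D₁) (cong (_* ℕ→ℚ D₁) (ℕ→ℚ-* (suc L₁) M)))))
      (ℕ→ℚ-mono-≤ counting)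
    at-k : D * K * K - L * K ≤ L * Mq * ℕ→ℚ D₁
    at-k = ≤-from-gap _ (solve 5 (λ D L K M D₁ → L :* M :* D₁ :- (D :* K :* K :- L :* K)
                                     := L :* K :+ L :* M :* D₁ :- D :* K :* K) refl D L K Mq (ℕ→ℚ D₁))
                        (gap-nonNeg counting-ℚ)
    at-x : D * x * x - L * x - L ≤ L * Mq * D
    at-x = begin
      D * x * x - L * x - L  ≤⟨ ≤-from-gap L (solve 2 (λ a L → a :- (a :- L) := L) refl (D * x * x - L * x) L) (ℕ→ℚ-nonNeg (suc L₁)) ⟩
      D * x * x - L * x      ≤⟨ quadratic-≤ {L = L} 0≤x x≤k (ℕ→ℚ-nonNeg (suc D₁)) (*-nonNeg 0≤LM (ℕ→ℚ-nonNeg D₁)) at-k ⟩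
      L * Mq * ℕ→ℚ D₁        ≤⟨ mulˡ-≤ (L * Mq) 0≤LM (ℕ→ℚ-mono-≤ (ℕP.n≤1+n D₁)) ⟩
      L * Mq * D             ∎
    scale-left : (D * x * x - L * x - L) * (rL * rD) ≡ x * x * rL - (x + 1ℚ) * rD
    scale-left = begin-equality
      (D * x * x - L * x - L) * (rL * rD)
        ≡⟨ solve 5 (λ x D L rL rD → (D :* x :* x :- L :* x :- L) :* (rL :* rD)
             := x :* x :* (D :* rD) :* rL :- x :* (L :* rL) :* rD :- (L :* rL) :* rD) refl x D L rL rD ⟩
      x * x * (D * rD) * rL - x * (L * rL) * rD - (L * rL) * rD
        ≡⟨ cong₂ (λ a b → x * x * a * rL - x * b * rD - b * rD) (ℕ→ℚ*recip D₁) (ℕ→ℚ*recip L₁) ⟩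
      x * x * 1ℚ * rL - x * 1ℚ * rD - 1ℚ * rD
        ≡⟨ solve 3 (λ x rL rD → x :* x :* con 1ℚ :* rL :- x :* con 1ℚ :* rD :- con 1ℚ :* rD
             := x :* x :* rL :- (x :+ con 1ℚ) :* rD) refl x rL rD ⟩
      x * x * rL - (x + 1ℚ) * rD ∎
    scale-right : L * Mq * D * (rL * rD) ≡ Mq
    scale-right = begin-equality
      L * Mq * D * (rL * rD) ≡⟨ solve 5 (λ L M D rL rD → L :* M :* D :* (rL :* rD) := M :* (L :* rL) :* (D :* rD)) refl L Mq D rL rD ⟩
      Mq * (L * rL) * (D * rD) ≡⟨ cong₂ (λ a b → Mq * a * b) (ℕ→ℚ*recip L₁) (ℕ→ℚ*recip D₁) ⟩
      Mq * 1ℚ * 1ℚ           ≡⟨ solve 1 (λ M → M :* con 1ℚ :* con 1ℚ := M) refl Mq ⟩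
      Mq                     ∎


module FiniteSums where

  open import Data.Nat
  open import Data.Nat.Properties
  open import Data.Nat.Solver using (module +-*-Solver)
  open +-*-Solver
  open import Relation.Binary.PropositionalEquality

  ∑< : ℕ → (ℕ → ℕ) → ℕ
  ∑< zero    f = 0
  ∑< (suc n) f = f 0 + ∑< n (λ i → f (suc i))

  ∑-cong : ∀ n {f g} → (∀ i → f i ≡ g i) → ∑< n f ≡ ∑< n g
  ∑-cong zero    f≡g = refl
  ∑-cong (suc n) f≡g = cong₂ _+_ (f≡g 0) (∑-cong n (λ i → f≡g (suc i)))

  ∑-mono : ∀ n {f g} → (∀ i → i < n → f i ≤ g i) → ∑< n f ≤ ∑< n g
  ∑-mono zero    f≤g = z≤n
  ∑-mono (suc n) f≤g = +-mono-≤ (f≤g 0 (s≤s z≤n)) (∑-mono n (λ i i<n → f≤g (suc i) (s≤s i<n)))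

  ∑-const : ∀ n c → ∑< n (λ _ → c) ≡ n * c
  ∑-const zero    c = refl
  ∑-const (suc n) c = cong (c +_) (∑-const n c)

  ∑-zero : ∀ n → ∑< n (λ _ → 0) ≡ 0
  ∑-zero n = trans (∑-const n 0) (*-zeroʳ n)

  ∑-+ : ∀ n f g → ∑< n (λ i → f i + g i) ≡ ∑< n f + ∑< n g
  ∑-+ zero    f g = refl
  ∑-+ (suc n) f g rewrite ∑-+ n (λ i → f (suc i)) (λ i → g (suc i)) =
    solve 4 (λ a b c d → (a :+ b) :+ (c :+ d) := (a :+ c) :+ (b :+ d)) refl
      (f 0) (g 0) (∑< n (λ i → f (suc i))) (∑< n (λ i → g (suc i)))

  ∑-*ˡ : ∀ n c f → ∑< n (λ i → c * f i) ≡ c * ∑< n f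
  ∑-*ˡ zero    c f = sym (*-zeroʳ c)
  ∑-*ˡ (suc n) c f rewrite ∑-*ˡ n c (λ i → f (suc i)) = sym (*-distribˡ-+ c (f 0) _)

  ∑-swap : ∀ n m (F : ℕ → ℕ → ℕ) → ∑< n (λ i → ∑< m (F i)) ≡ ∑< m (λ j → ∑< n (λ i → F i j))
  ∑-swap zero    m F = sym (∑-zero m)
  ∑-swap (suc n) m F rewrite ∑-swap n m (λ i → F (suc i)) = sym (∑-+ m (F 0) (λ j → ∑< n (λ i → F (suc i) j)))

  ∑-split : ∀ s n f → ∑< (s + n) f ≡ ∑< s f + ∑< n (λ i → f (s + i))
  ∑-split zero    n f = refl
  ∑-split (suc s) n f rewrite ∑-split s n (λ i → f (suc i)) = sym (+-assoc (f 0) _ _)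

  ∑-mono-length : ∀ {a b} f → a ≤ b → ∑< a f ≤ ∑< b f
  ∑-mono-length {a} {b} f a≤b = begin
    ∑< a f                              ≤⟨ m≤m+n (∑< a f) _ ⟩
    ∑< a f + ∑< (b ∸ a) (λ i → f (a + i)) ≡⟨ ∑-split a (b ∸ a) f ⟨
    ∑< (a + (b ∸ a)) f                  ≡⟨ cong (λ t → ∑< t f) (m+[n∸m]≡n a≤b) ⟩
    ∑< b f                              ∎
    where open ≤-Reasoning

  ∑-shift-≤ : ∀ s n f → ∑< n (λ i → f (i + s)) ≤ ∑< (s + n) f
  ∑-shift-≤ s n f = begin
    ∑< n (λ i → f (i + s))          ≡⟨ ∑-cong n (λ i → cong f (+-comm i s)) ⟩
    ∑< n (λ i → f (s + i))          ≤⟨ m≤n+m _ (∑< s f) ⟩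
    ∑< s f + ∑< n (λ i → f (s + i)) ≡⟨ ∑-split s n f ⟨
    ∑< (s + n) f                    ∎
    where open ≤-Reasoning

  ∑-square-expand : ∀ n (a w : ℕ → ℕ) → ∑< n (λ i → (a i + w i) * (a i + w i))
                             ≡ ∑< n (λ i → a i * a i) + 2 * ∑< n (λ i → a i * w i) + ∑< n (λ i → w i * w i)
  ∑-square-expand n a w = begin
    ∑< n (λ i → (a i + w i) * (a i + w i))
      ≡⟨ ∑-cong n (λ i → square-expand (a i) (w i)) ⟩
    ∑< n (λ i → a i * a i + 2 * (a i * w i) + w i * w i)
      ≡⟨ trans (∑-+ n (λ i → a i * a i + 2 * (a i * w i)) (λ i → w i * w i))
               (cong (_+ ∑< n (λ i → w i * w i)) (∑-+ n (λ i → a i * a i) (λ i → 2 * (a i * w i)))) ⟩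
    ∑< n (λ i → a i * a i) + ∑< n (λ i → 2 * (a i * w i)) + ∑< n (λ i → w i * w i)
      ≡⟨ cong (λ t → ∑< n (λ i → a i * a i) + t + ∑< n (λ i → w i * w i)) (∑-*ˡ n 2 (λ i → a i * w i)) ⟩
    ∑< n (λ i → a i * a i) + 2 * ∑< n (λ i → a i * w i) + ∑< n (λ i → w i * w i) ∎
    where
    open ≡-Reasoning
    square-expand : ∀ x y → (x + y) * (x + y) ≡ x * x + 2 * (x * y) + y * y
    square-expand = solve 2 (λ x y → (x :+ y) :* (x :+ y) := x :* x :+ con 2 :* (x :* y) :+ y :* y) refl


module Correlation where

  open import Defs
  open FiniteSums
  open import Data.Nat
  open import Data.Nat.Properties
  open import Data.Bool using (Bool; true; false; if_then_else_)
  open import Data.Fin using (Fin; toℕ) renaming (zero to fzero; suc to fsuc)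
  open import Data.Fin.Subset using (Subset; inside; outside)
  open import Data.Fin.Subset.Properties using (_∈?_)
  open import Data.Vec using (_∷_; [])
  open import Data.List using (List; []; _∷_; map; filter; concat; concatMap; length; _++_; allFin)
  import Data.List.Properties as List
  open import Data.Product using (_×_; _,_)
  open import Relation.Binary.PropositionalEquality
  open import Relation.Nullary using (Dec; yes; no; does)
  open import Algebra.Properties.CommutativeSemigroup *-commutativeSemigroup using (x∙yz≈y∙xz)

  bit : Bool → ℕ
  bit true  = 1
  bit false = 0

  χ : ∀ {N} → Subset N → ℕ → ℕ
  χ []      _       = 0
  χ (b ∷ p) zero    = bit b
  χ (b ∷ p) (suc n) = χ p n

  χ-boolean : ∀ {N} (p : Subset N) n → χ p n * χ p n ≤ χ p n
  χ-boolean []            n       = z≤n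
  χ-boolean (true  ∷ p)   zero    = s≤s z≤n
  χ-boolean (false ∷ p)   zero    = z≤n
  χ-boolean (b ∷ p)       (suc n) = χ-boolean p n

  listSum : ∀ {a} {A : Set a} → (A → ℕ) → List A → ℕ
  listSum h []       = 0
  listSum h (x ∷ xs) = h x + listSum h xs

  listSum-++ : ∀ {a} {A : Set a} (h : A → ℕ) xs ys → listSum h (xs ++ ys) ≡ listSum h xs + listSum h ys
  listSum-++ h []       ys = refl
  listSum-++ h (x ∷ xs) ys = trans (cong (h x +_) (listSum-++ h xs ys)) (sym (+-assoc (h x) _ _))

  listSum-map : ∀ {a b} {A : Set a} {B : Set b} (h : B → ℕ) (g : A → B) xs →
                listSum h (map g xs) ≡ listSum (λ x → h (g x)) xs
  listSum-map h g []       = refl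
  listSum-map h g (x ∷ xs) = cong (h (g x) +_) (listSum-map h g xs)

  listSum-concatMap : ∀ {a b} {A : Set a} {B : Set b} (h : B → ℕ) (g : A → List B) xs →
                      listSum h (concatMap g xs) ≡ listSum (λ x → listSum h (g x)) xs
  listSum-concatMap h g []       = refl
  listSum-concatMap h g (x ∷ xs) =
    trans (listSum-++ h (g x) (concat (map g xs))) (cong (listSum h (g x) +_) (listSum-concatMap h g xs))

  listSum-cong : ∀ {a} {A : Set a} {h h′ : A → ℕ} xs → (∀ x → h x ≡ h′ x) → listSum h xs ≡ listSum h′ xs
  listSum-cong []       h≡h′ = refl
  listSum-cong (x ∷ xs) h≡h′ = cong₂ _+_ (h≡h′ x) (listSum-cong xs h≡h′)

  length-filter : ∀ {a p} {A : Set a} {P : A → Set p} (P? : ∀ x → Dec (P x)) xs →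
                  length (filter P? xs) ≡ listSum (λ x → if does (P? x) then 1 else 0) xs
  length-filter P? []       = refl
  length-filter P? (x ∷ xs) with does (P? x)
  ... | true  = cong suc (length-filter P? xs)
  ... | false = length-filter P? xs

  members-shift : ∀ {n} b (q : Subset n) (xs : List (Fin n)) →
    filter (_∈? (b ∷ q)) (map fsuc xs) ≡ map fsuc (filter (_∈? q) xs)
  members-shift b q []       = refl
  members-shift b q (x ∷ xs) with x ∈? q
  ... | yes _ = cong (fsuc x ∷_) (members-shift b q xs)
  ... | no  _ = members-shift b q xs

  members-inside : ∀ {n} (q : Subset n) → members (inside ∷ q) ≡ fzero ∷ map fsuc (members q)
  members-inside {n} q = cong (fzero ∷_) (trans
    (cong (filter (_∈? (inside ∷ q))) (sym (List.map-tabulate (λ i → i) fsuc)))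
    (members-shift inside q (allFin n)))

  members-outside : ∀ {n} (q : Subset n) → members (outside ∷ q) ≡ map fsuc (members q)
  members-outside {n} q = trans
    (cong (filter (_∈? (outside ∷ q))) (sym (List.map-tabulate (λ i → i) fsuc)))
    (members-shift outside q (allFin n))

  sum-over-members : ∀ {N} (p : Subset N) (G : ℕ → ℕ) →
                     listSum (λ a → G (toℕ a)) (members p) ≡ ∑< N (λ n → χ p n * G n)
  sum-over-members []          G = refl
  sum-over-members {suc N} (true ∷ q)  G = begin
    listSum (λ a → G (toℕ a)) (members (inside ∷ q))     ≡⟨ cong (listSum (λ a → G (toℕ a))) (members-inside q) ⟩
    G 0 + listSum (λ a → G (toℕ a)) (map fsuc (members q)) ≡⟨ cong (G 0 +_) (listSum-map (λ a → G (toℕ a)) fsuc (members q)) ⟩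
    G 0 + listSum (λ a → G (suc (toℕ a))) (members q)     ≡⟨ cong (G 0 +_) (sum-over-members q (λ n → G (suc n))) ⟩
    G 0 + ∑< N (λ n → χ q n * G (suc n))                 ≡⟨ cong (_+ ∑< N (λ n → χ q n * G (suc n))) (+-identityʳ (G 0)) ⟨
    G 0 + 0 + ∑< N (λ n → χ q n * G (suc n))             ∎
    where open ≡-Reasoning
  sum-over-members {suc N} (false ∷ q) G = begin
    listSum (λ a → G (toℕ a)) (members (outside ∷ q))    ≡⟨ cong (listSum (λ a → G (toℕ a))) (members-outside q) ⟩
    listSum (λ a → G (toℕ a)) (map fsuc (members q))     ≡⟨ listSum-map (λ a → G (toℕ a)) fsuc (members q) ⟩
    listSum (λ a → G (suc (toℕ a))) (members q)         ≡⟨ sum-over-members q (λ n → G (suc n)) ⟩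
    ∑< N (λ n → χ q n * G (suc n))                     ∎
    where open ≡-Reasoning

  δ : ℕ → ℕ → ℕ
  δ u m = if does (u ≟ m) then 1 else 0

  ∑-δ : ∀ {N} (p : Subset N) m → ∑< N (λ u → χ p u * δ u m) ≡ χ p m
  ∑-δ []                m       = refl
  ∑-δ {suc N} (b ∷ q) zero    = begin
    bit b * 1 + ∑< N (λ u → χ q u * 0) ≡⟨ cong₂ _+_ (*-identityʳ (bit b)) (trans (∑-cong N (λ u → *-zeroʳ (χ q u))) (∑-zero N)) ⟩
    bit b + 0                          ≡⟨ +-identityʳ (bit b) ⟩
    bit b                              ∎
    where open ≡-Reasoning
  ∑-δ {suc N} (b ∷ q) (suc m) = trans (cong (_+ ∑< N (λ u → χ q u * δ u m)) (*-zeroʳ (bit b))) (∑-δ q m)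

  r-as-correlation : ∀ {N} (p : Subset N) d → r p d ≡ ∑< N (λ n → χ p n * χ p (n + d))
  r-as-correlation {N} p d = begin
    r p d
      ≡⟨ length-filter _ (pairs p) ⟩
    listSum hit (pairs p)
      ≡⟨ listSum-concatMap hit (λ a → map (λ a′ → val a , val a′) (members p)) (members p) ⟩
    listSum (λ a → listSum hit (map (λ a′ → val a , val a′) (members p))) (members p)
      ≡⟨ listSum-cong (members p) (λ a → trans (listSum-map hit (λ a′ → val a , val a′) (members p))
                                               (sum-over-members p (λ n → δ (toℕ a) (n + d)))) ⟩
    listSum (λ a → ∑< N (λ n → χ p n * δ (toℕ a) (n + d))) (members p)
      ≡⟨ sum-over-members p (λ u → ∑< N (λ n → χ p n * δ u (n + d))) ⟩
    ∑< N (λ u → χ p u * ∑< N (λ n → χ p n * δ u (n + d)))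
      ≡⟨ ∑-cong N (λ u → sym (∑-*ˡ N (χ p u) _)) ⟩
    ∑< N (λ u → ∑< N (λ n → χ p u * (χ p n * δ u (n + d))))
      ≡⟨ ∑-swap N N _ ⟩
    ∑< N (λ n → ∑< N (λ u → χ p u * (χ p n * δ u (n + d))))
      ≡⟨ ∑-cong N (λ n → trans (∑-cong N (λ u → x∙yz≈y∙xz (χ p u) (χ p n) _)) (∑-*ˡ N (χ p n) _)) ⟩
    ∑< N (λ n → χ p n * ∑< N (λ u → χ p u * δ u (n + d)))
      ≡⟨ ∑-cong N (λ n → cong (χ p n *_) (∑-δ p (n + d))) ⟩
    ∑< N (λ n → χ p n * χ p (n + d)) ∎
    where
    open ≡-Reasoning
    hit : ℕ × ℕ → ℕ
    hit (a , a′) = if does (a ≟ a′ + d) then 1 else 0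


module WindowInequality where

  open FiniteSums
  open import Data.Nat
  open import Data.Nat.Properties
  open import Data.Product using (_,_)
  open import Data.Sum using (inj₁; inj₂)
  open import Relation.Binary.PropositionalEquality
  open import Data.Nat.Solver using (module +-*-Solver)
  open +-*-Solver

  -- 2ab ≤ a² + b², i.e. (a − b)² ≥ 0, over ℕ; first for a ≤ b, writing b = a + t.
  2ab≤a²+b²-ordered : ∀ a b → a ≤ b → 2 * (a * b) ≤ a * a + b * b
  2ab≤a²+b²-ordered a b a≤b with m≤n⇒∃[o]m+o≡n a≤b
  ... | t , refl = subst₂ _≤_
    (solve 2 (λ a t → a :* a :+ a :* a :+ con 2 :* (a :* t) := con 2 :* (a :* (a :+ t))) refl a t)
    (solve 2 (λ a t → a :* a :+ a :* a :+ con 2 :* (a :* t) :+ t :* t := a :* a :+ (a :+ t) :* (a :+ t)) refl a t)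
    (m≤m+n _ (t * t))

  2ab≤a²+b² : ∀ a b → 2 * (a * b) ≤ a * a + b * b
  2ab≤a²+b² a b with ≤-total a b
  ... | inj₁ a≤b = 2ab≤a²+b²-ordered a b a≤b
  ... | inj₂ b≤a = subst₂ _≤_ (cong (2 *_) (*-comm b a)) (+-comm (b * b) (a * a)) (2ab≤a²+b²-ordered b a b≤a)

  cauchy-schwarz : ∀ n w → ∑< n w * ∑< n w ≤ n * ∑< n (λ x → w x * w x)
  cauchy-schwarz zero    w = z≤n
  cauchy-schwarz (suc n) w = begin
    (a + T) * (a + T)              ≡⟨ solve 2 (λ a T → (a :+ T) :* (a :+ T) := a :* a :+ con 2 :* (a :* T) :+ T :* T) refl a T ⟩
    a * a + 2 * (a * T) + T * T    ≤⟨ +-mono-≤ (+-monoʳ-≤ (a * a) cross) (cauchy-schwarz n w′) ⟩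
    a * a + (n * (a * a) + Q) + n * Q ≡⟨ solve 3 (λ a Q n → a :* a :+ (n :* (a :* a) :+ Q) :+ n :* Q := (con 1 :+ n) :* (a :* a :+ Q)) refl a Q n ⟩
    suc n * (a * a + Q)            ∎
    where
    open ≤-Reasoning
    a = w 0
    w′ = λ x → w (suc x)
    T = ∑< n w′
    Q = ∑< n (λ x → w′ x * w′ x)
    -- each cross term 2 a w′(x) is at most a² + w′(x)²
    cross : 2 * (a * T) ≤ n * (a * a) + Q
    cross = begin
      2 * (a * T)                     ≡⟨ cong (2 *_) (∑-*ˡ n a w′) ⟨
      2 * ∑< n (λ x → a * w′ x)       ≡⟨ ∑-*ˡ n 2 _ ⟨
      ∑< n (λ x → 2 * (a * w′ x))     ≤⟨ ∑-mono n (λ x _ → 2ab≤a²+b² a (w′ x)) ⟩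
      ∑< n (λ x → a * a + w′ x * w′ x) ≡⟨ ∑-+ n _ _ ⟩
      ∑< n (λ _ → a * a) + Q          ≡⟨ cong (_+ Q) (∑-const n (a * a)) ⟩
      n * (a * a) + Q                 ∎

  window : (ℕ → ℕ) → ℕ → ℕ → ℕ
  window v n y = ∑< n (λ i → v (i + y))

  window-suc : ∀ v n y → window v (suc n) y ≡ v y + window v n (suc y)
  window-suc v n y = cong (v y +_) (∑-cong n (λ i → cong v (sym (+-suc i y))))

  module _ (v : ℕ → ℕ) (k M D₁ : ℕ)
           (boolean : ∀ y → v y * v y ≤ v y)
           (mass : ∀ s L → ∑< L (λ x → v (x + s)) ≤ k)
           (correlation : ∀ s L d → 1 ≤ d → d ≤ D₁ → ∑< L (λ x → v (x + s) * v (x + s + d)) ≤ M)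
           where

    cross-term : ∀ n → n ≤ D₁ → ∀ s L → ∑< L (λ x → v (x + s) * window v n (suc (x + s))) ≤ n * M
    cross-term n n≤D₁ s L = begin
      ∑< L (λ x → v (x + s) * window v n (suc (x + s)))
        ≡⟨ ∑-cong L (λ x → sym (∑-*ˡ n (v (x + s)) _)) ⟩
      ∑< L (λ x → ∑< n (λ i → v (x + s) * v (i + suc (x + s))))
        ≡⟨ ∑-swap L n _ ⟩
      ∑< n (λ i → ∑< L (λ x → v (x + s) * v (i + suc (x + s))))
        ≡⟨ ∑-cong n (λ i → ∑-cong L (λ x → cong (λ z → v (x + s) * v z) (trans (+-suc i (x + s)) (+-comm (suc i) (x + s))))) ⟩
      ∑< n (λ i → ∑< L (λ x → v (x + s) * v (x + s + suc i)))
        ≤⟨ ∑-mono n (λ i i<n → correlation s L (suc i) (s≤s z≤n) (≤-trans i<n n≤D₁)) ⟩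
      ∑< n (λ _ → M)
        ≡⟨ ∑-const n M ⟩
      n * M ∎
      where open ≤-Reasoning

    -- Energy of the windows of length n ≤ D₁ + 1:
    -- ∑_x window(x)² ≤ n k + n (n − 1) M, stated without subtraction.
    window-energy : ∀ n → n ≤ suc D₁ → ∀ s L →
      ∑< L (λ x → window v n (x + s) * window v n (x + s)) + n * M ≤ n * k + n * n * M
    window-energy zero    _      s L = ≤-reflexive (cong (_+ 0) (∑-zero L))
    window-energy (suc n) n<D₁+1 s L = begin
      ∑< L (λ x → window v (suc n) (x + s) * window v (suc n) (x + s)) + suc n * M
        ≡⟨ cong (_+ suc n * M) (trans (∑-cong L (λ x → cong (λ z → z * z) (window-suc v n (x + s)))) (∑-square-expand L a w)) ⟩
      ∑< L (λ x → a x * a x) + 2 * ∑< L (λ x → a x * w x) + ∑< L (λ x → w x * w x) + suc n * M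
        ≤⟨ +-monoˡ-≤ (suc n * M) (+-monoˡ-≤ (∑< L (λ x → w x * w x))
             (+-mono-≤ (≤-trans (∑-mono L (λ x _ → boolean (x + s))) (mass s L))
                       (*-monoʳ-≤ 2 (cross-term n (s≤s⁻¹ n<D₁+1) s L)))) ⟩
      k + 2 * (n * M) + ∑< L (λ x → w x * w x) + suc n * M
        ≡⟨ solve 4 (λ k n M E → k :+ con 2 :* (n :* M) :+ E :+ (con 1 :+ n) :* M
                              := k :+ con 2 :* (n :* M) :+ M :+ (E :+ n :* M)) refl k n M (∑< L (λ x → w x * w x)) ⟩
      k + 2 * (n * M) + M + (∑< L (λ x → w x * w x) + n * M)
        ≤⟨ +-monoʳ-≤ (k + 2 * (n * M) + M) (subst (λ E → E + n * M ≤ n * k + n * n * M) shift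
             (window-energy n (m≤n⇒m≤1+n (s≤s⁻¹ n<D₁+1)) (suc s) L)) ⟩
      k + 2 * (n * M) + M + (n * k + n * n * M)
        ≡⟨ solve 3 (λ k n M → k :+ con 2 :* (n :* M) :+ M :+ (n :* k :+ n :* n :* M)
                            := (con 1 :+ n) :* k :+ (con 1 :+ n) :* (con 1 :+ n) :* M) refl k n M ⟩
      suc n * k + suc n * suc n * M ∎
      where
      open ≤-Reasoning
      a = λ x → v (x + s)
      w = λ x → window v n (suc (x + s))
      shift : ∑< L (λ x → window v n (x + suc s) * window v n (x + suc s)) ≡ ∑< L (λ x → w x * w x)
      shift = ∑-cong L (λ x → cong (λ y → window v n y * window v n y) (+-suc x s))

    -- If moreover every shift of v by i ≤ D₁ keeps mass ≥ k inside [0, L),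
    -- double counting the windows of length D = D₁ + 1 and Cauchy–Schwarz give
    -- D k² ≤ L k + L M (D − 1).
    window-inequality : ∀ L → (∀ i → i ≤ D₁ → k ≤ ∑< L (λ x → v (i + x))) →
                        suc D₁ * k * k ≤ L * k + L * M * D₁
    window-inequality L shifted-mass = *-cancelˡ-≤ D (+-cancelʳ-≤ (L * (D * M)) _ _ (begin
      D * (D * k * k) + L * (D * M)       ≡⟨ cong (_+ L * (D * M)) (solve 2 (λ D k → D :* (D :* k :* k) := (D :* k) :* (D :* k)) refl D k) ⟩
      D * k * (D * k) + L * (D * M)       ≤⟨ +-monoˡ-≤ (L * (D * M)) (*-mono-≤ total total) ⟩
      ∑< L W * ∑< L W + L * (D * M)       ≤⟨ +-monoˡ-≤ (L * (D * M)) (cauchy-schwarz L W) ⟩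
      L * ∑< L W² + L * (D * M)           ≡⟨ *-distribˡ-+ L (∑< L W²) (D * M) ⟨
      L * (∑< L W² + D * M)               ≤⟨ *-monoʳ-≤ L energy ⟩
      L * (D * k + D * D * M)             ≡⟨ solve 4 (λ L D₁ k M → L :* ((con 1 :+ D₁) :* k :+ (con 1 :+ D₁) :* (con 1 :+ D₁) :* M)
                                               := (con 1 :+ D₁) :* (L :* k :+ L :* M :* D₁) :+ L :* ((con 1 :+ D₁) :* M)) refl L D₁ k M ⟩
      D * (L * k + L * M * D₁) + L * (D * M) ∎))
      where
      open ≤-Reasoning
      D = suc D₁
      W = window v D
      W² = λ x → W x * W x
      -- every point of mass is seen by D windows
      total : D * k ≤ ∑< L W
      total = begin
        D * k                         ≡⟨ ∑-const D k ⟨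
        ∑< D (λ _ → k)                ≤⟨ ∑-mono D (λ i i<D → shifted-mass i (s≤s⁻¹ i<D)) ⟩
        ∑< D (λ i → ∑< L (λ x → v (i + x))) ≡⟨ ∑-swap D L (λ i x → v (i + x)) ⟩
        ∑< L W                        ∎
      energy : ∑< L W² + D * M ≤ D * k + D * D * M
      energy = subst (λ E → E + D * M ≤ D * k + D * D * M)
                     (∑-cong L (λ x → cong (λ y → W y * W y) (+-identityʳ x)))
                     (window-energy D ≤-refl 0 L)


module MaxMinFolds where

  open import Defs
  open import Data.Nat
  open import Data.Nat.Properties
  open import Data.Rational as ℚ using (ℚ)
  open import Data.Fin.Subset using (Subset; ⊤; ∣_∣)
  open import Data.List using ([]; _∷_; map; filter; foldr; applyUpTo)
  open import Data.Sum using (inj₁; inj₂)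
  open import Relation.Binary.PropositionalEquality
  open import Relation.Nullary using (Dec; yes; no)

  ≤-max-applyUpTo : ∀ n (f g : ℕ → ℕ) j → j < n → g (f j) ≤ foldr _⊔_ 0 (map g (applyUpTo f n))
  ≤-max-applyUpTo (suc n) f g zero    _   = m≤m⊔n _ _
  ≤-max-applyUpTo (suc n) f g (suc j) j<n =
    ≤-trans (≤-max-applyUpTo n (λ i → f (suc i)) g j (s≤s⁻¹ j<n)) (m≤n⊔m (g (f 0)) _)

  max-applyUpTo-mono : ∀ n t (f g : ℕ → ℕ) →
    foldr _⊔_ 0 (map g (applyUpTo f n)) ≤ foldr _⊔_ 0 (map g (applyUpTo f (n + t)))
  max-applyUpTo-mono zero    t f g = z≤n
  max-applyUpTo-mono (suc n) t f g = ⊔-mono-≤ (≤-refl {g (f 0)}) (max-applyUpTo-mono n t (λ i → f (suc i)) g)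

  r≤M : ∀ {N} (p : Subset N) D₁ d → 1 ≤ d → d ≤ D₁ → r p d ≤ M (suc D₁) p
  r≤M p D₁ (suc j) _ d≤D₁ = ≤-max-applyUpTo D₁ (λ i → i) (λ i → r p (suc i)) j d≤D₁

  M-mono : ∀ {N} (p : Subset N) {D′ D} → D′ ≤ D → M D′ p ≤ M D p
  M-mono p {D′} {D} D′≤D = subst (λ t → M D′ p ≤ foldr _⊔_ 0 (map (λ j → r p (suc j)) (applyUpTo (λ i → i) t)))
    (m+[n∸m]≡n (∸-monoˡ-≤ 1 D′≤D))
    (max-applyUpTo-mono (D′ ∸ 1) ((D ∸ 1) ∸ (D′ ∸ 1)) (λ i → i) (λ j → r p (suc j)))

  min-fold-mono : ∀ {A : Set} (g h : A → ℕ) {z z′} xs → z ≤ z′ → (∀ x → g x ≤ h x) →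
    foldr _⊓_ z (map g xs) ≤ foldr _⊓_ z′ (map h xs)
  min-fold-mono g h []       z≤z′ g≤h = z≤z′
  min-fold-mono g h (x ∷ xs) z≤z′ g≤h = ⊓-mono-≤ (g≤h x) (min-fold-mono g h xs z≤z′ g≤h)

  f-mono : ∀ {D′ D} N α → D′ ≤ D → f D′ N α ≤ f D N α
  f-mono {D′} {D} N α D′≤D =
    min-fold-mono (M D′) (M D) (filter (λ p → (α ℚ.* ℕ→ℚ N) ℚ.≤? ℕ→ℚ ∣ p ∣) (allSubsets N))
                  (M-mono (⊤ {N}) D′≤D) (λ p → M-mono p D′≤D)

  min-fold-lower-bound : ∀ {A : Set} {P : A → Set} (P? : ∀ x → Dec (P x)) (c : ℚ) (g : A → ℕ) xs z →
    c ℚ.≤ ℕ→ℚ z → (∀ x → P x → c ℚ.≤ ℕ→ℚ (g x)) → c ℚ.≤ ℕ→ℚ (foldr _⊓_ z (map g (filter P? xs)))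
  min-fold-lower-bound P? c g []       z c≤z c≤g = c≤z
  min-fold-lower-bound P? c g (x ∷ xs) z c≤z c≤g with P? x
  ... | no  _  = min-fold-lower-bound P? c g xs z c≤z c≤g
  ... | yes Px with ⊓-sel (g x) (foldr _⊓_ z (map g (filter P? xs)))
  ...   | inj₁ eq = subst (λ t → c ℚ.≤ ℕ→ℚ t) (sym eq) (c≤g x Px)
  ...   | inj₂ eq = subst (λ t → c ℚ.≤ ℕ→ℚ t) (sym eq) (min-fold-lower-bound P? c g xs z c≤z c≤g)


module DensityBound where

  open import Defs
  open RationalFacts
  open RationalReading
  open FiniteSums
  open Correlation
  open WindowInequality
  open MaxMinFolds
  open import Data.Nat
  open import Data.Nat.Properties
  open import Data.Bool using (true; false)
  open import Data.Fin.Subset using (Subset; outside; ⊤; ∣_∣)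
  open import Data.Fin.Subset.Properties using (∣⊤∣≡n)
  open import Data.Vec using ([]; _∷_)
  open import Data.Rational as ℚ using (ℚ; 0ℚ; 1ℚ)
  import Data.Rational.Properties as ℚP
  open import Data.Product using (_,_)
  open import Relation.Binary.PropositionalEquality

  pad : ∀ {N} j → Subset N → Subset (j + N)
  pad zero    p = p
  pad (suc j) p = outside ∷ pad j p

  pad-χ : ∀ {N} i j (q : Subset N) x → χ (pad (i + j) q) (i + x) ≡ χ (pad j q) x
  pad-χ zero    j q x = refl
  pad-χ (suc i) j q x = pad-χ i j q x

  χ-prefix-mass : ∀ {N} (q : Subset N) T → ∑< T (χ q) ≤ ∣ q ∣
  χ-prefix-mass []          T       = ≤-reflexive (∑-zero T)
  χ-prefix-mass (b ∷ q)     zero    = z≤n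
  χ-prefix-mass (true ∷ q)  (suc T) = s≤s (χ-prefix-mass q T)
  χ-prefix-mass (false ∷ q) (suc T) = χ-prefix-mass q T

  pad-prefix-mass : ∀ {N} j (q : Subset N) T → ∑< T (χ (pad j q)) ≤ ∣ q ∣
  pad-prefix-mass zero    q T       = χ-prefix-mass q T
  pad-prefix-mass (suc j) q zero    = z≤n
  pad-prefix-mass (suc j) q (suc T) = pad-prefix-mass j q T

  pad-mass : ∀ {N} j (q : Subset N) → ∑< (j + N) (χ (pad j q)) ≡ ∣ q ∣
  pad-mass zero    []          = refl
  pad-mass zero    (true ∷ q)  = cong suc (pad-mass zero q)
  pad-mass zero    (false ∷ q) = pad-mass zero q
  pad-mass (suc j) q           = pad-mass j q

  χ-prefix-correlation : ∀ {N} (q : Subset N) (h : ℕ → ℕ) T →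
    ∑< T (λ y → χ q y * h y) ≤ ∑< N (λ y → χ q y * h y)
  χ-prefix-correlation []      h T       = ≤-reflexive (∑-zero T)
  χ-prefix-correlation (b ∷ q) h zero    = z≤n
  χ-prefix-correlation (b ∷ q) h (suc T) = +-monoʳ-≤ (bit b * h 0) (χ-prefix-correlation q (λ y → h (suc y)) T)

  pad-prefix-correlation : ∀ {N} j (q : Subset N) d T →
    ∑< T (λ y → χ (pad j q) y * χ (pad j q) (y + d)) ≤ ∑< N (λ y → χ q y * χ q (y + d))
  pad-prefix-correlation zero    q d T       = χ-prefix-correlation q (λ y → χ q (y + d)) T
  pad-prefix-correlation (suc j) q d zero    = z≤n
  pad-prefix-correlation (suc j) q d (suc T) = pad-prefix-correlation j q d T

  density-inequality : ∀ {N} (p : Subset N) D₁ →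
    suc D₁ * ∣ p ∣ * ∣ p ∣ ≤ (N + suc D₁) * ∣ p ∣ + (N + suc D₁) * M (suc D₁) p * D₁
  density-inequality {N} p D₁ =
    window-inequality v ∣ p ∣ (M (suc D₁) p) D₁ (χ-boolean (pad D₁ p)) mass correlation (N + suc D₁) shifted-mass
    where
    v = χ (pad D₁ p)
    mass : ∀ s L → ∑< L (λ x → v (x + s)) ≤ ∣ p ∣
    mass s L = ≤-trans (∑-shift-≤ s L v) (pad-prefix-mass D₁ p (s + L))
    correlation : ∀ s L d → 1 ≤ d → d ≤ D₁ → ∑< L (λ x → v (x + s) * v (x + s + d)) ≤ M (suc D₁) p
    correlation s L d 1≤d d≤D₁ = begin
      ∑< L (λ x → v (x + s) * v (x + s + d))     ≤⟨ ∑-shift-≤ s L (λ y → v y * v (y + d)) ⟩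
      ∑< (s + L) (λ y → v y * v (y + d))         ≤⟨ pad-prefix-correlation D₁ p d (s + L) ⟩
      ∑< N (λ y → χ p y * χ p (y + d))           ≡⟨ r-as-correlation p d ⟨
      r p d                                      ≤⟨ r≤M p D₁ d 1≤d d≤D₁ ⟩
      M (suc D₁) p                               ∎
      where open ≤-Reasoning
    -- shifting left by i ≤ D₁ only discards padding
    shifted-mass : ∀ i → i ≤ D₁ → ∣ p ∣ ≤ ∑< (N + suc D₁) (λ x → v (i + x))
    shifted-mass i i≤D₁ with m≤n⇒∃[o]m+o≡n i≤D₁
    ... | j , refl = begin
      ∣ p ∣                                        ≡⟨ pad-mass j p ⟨
      ∑< (j + N) (χ (pad j p))                     ≤⟨ ∑-mono-length (χ (pad j p)) j+N≤L ⟩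
      ∑< (N + suc (i + j)) (χ (pad j p))           ≡⟨ ∑-cong (N + suc (i + j)) (pad-χ i j p) ⟨
      ∑< (N + suc (i + j)) (λ x → χ (pad (i + j) p) (i + x)) ∎
      where
      open ≤-Reasoning
      j+N≤L : j + N ≤ N + suc (i + j)
      j+N≤L = subst (j + N ≤_) (+-comm (suc (i + j)) N) (+-monoˡ-≤ N (m≤n⇒m≤1+n (m≤n+m j i)))

  main-inequality : ∀ D₁ N (α : ℚ) → 0ℚ ℚ.≤ α → α ℚ.≤ 1ℚ →
    (α ℚ.* α ℚ.* ℕ→ℚ N ℚ.* ℕ→ℚ N) ℚ.* recip (N + suc D₁) ℚ.- (α ℚ.* ℕ→ℚ N ℚ.+ 1ℚ) ℚ.* recip (suc D₁)
      ℚ.≤ ℕ→ℚ (f (suc D₁) N α)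
  main-inequality D₁ N α 0≤α α≤1 =
    min-fold-lower-bound (λ p → x ℚ.≤? ℕ→ℚ ∣ p ∣) _ (M (suc D₁)) (allSubsets N) (M (suc D₁) (⊤ {N})) (bound ⊤ x≤|⊤|) bound
    where
    x = α ℚ.* ℕ→ℚ N
    bound : ∀ (p : Subset N) → x ℚ.≤ ℕ→ℚ ∣ p ∣ →
      (α ℚ.* α ℚ.* ℕ→ℚ N ℚ.* ℕ→ℚ N) ℚ.* recip (N + suc D₁) ℚ.- (x ℚ.+ 1ℚ) ℚ.* recip (suc D₁) ℚ.≤ ℕ→ℚ (M (suc D₁) p)
    bound p x≤|p| = subst (ℚ._≤ ℕ→ℚ (M (suc D₁) p)) (sym same-target)
      (rational-reading x ∣ p ∣ (M (suc D₁) p) (N + D₁) D₁ (*-nonNeg 0≤α (ℕ→ℚ-nonNeg N)) x≤|p|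
        (subst (λ L → suc D₁ * ∣ p ∣ * ∣ p ∣ ≤ L * ∣ p ∣ + L * M (suc D₁) p * D₁) (+-suc N D₁) (density-inequality p D₁)))
      where
      same-target : (α ℚ.* α ℚ.* ℕ→ℚ N ℚ.* ℕ→ℚ N) ℚ.* recip (N + suc D₁) ℚ.- (x ℚ.+ 1ℚ) ℚ.* recip (suc D₁)
                    ≡ x ℚ.* x ℚ.* recip (suc (N + D₁)) ℚ.- (x ℚ.+ 1ℚ) ℚ.* recip (suc D₁)
      same-target = cong₂ (λ a b → a ℚ.* b ℚ.- (x ℚ.+ 1ℚ) ℚ.* recip (suc D₁))
        (solve 2 (λ a n → a :* a :* n :* n := a :* n :* (a :* n)) refl α (ℕ→ℚ N))
        (cong recip (+-suc N D₁))
        where open import Data.Rational.Solver using (module +-*-Solver)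
              open +-*-Solver
    x≤|⊤| : x ℚ.≤ ℕ→ℚ ∣ ⊤ {N} ∣
    x≤|⊤| = subst (λ t → x ℚ.≤ ℕ→ℚ t) (sym (∣⊤∣≡n N))
      (subst (x ℚ.≤_) (ℚP.*-identityˡ (ℕ→ℚ N)) (mulʳ-≤ (ℕ→ℚ N) (ℕ→ℚ-nonNeg N) α≤1))


module Asymptotics where

  open import Defs
  open RationalFacts
  open MaxMinFolds using (f-mono)
  open DensityBound using (main-inequality)
  open import Data.Nat as ℕ using (ℕ; suc; s≤s; z≤n)
  import Data.Nat.Properties as ℕP
  open import Data.Nat.DivMod using (_/_; _%_; m≡m%n+[m/n]*n; m%n<n)
  open import Data.Integer using (+_; +[1+_]; -[1+_])
  open import Data.Rational using (ℚ; mkℚ; 0ℚ; 1ℚ; _*_; _-_; _<_; _≤_; _+_; positive)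
  open import Data.Rational.Properties
  open import Data.Rational.Solver using (module +-*-Solver)
  open +-*-Solver
  open import Data.Product using (_×_; _,_; ∃-syntax)
  open import Data.Sum using ([_,_]′)
  open import Relation.Binary.PropositionalEquality

  2ℚ 3ℚ : ℚ
  2ℚ = ℕ→ℚ 2
  3ℚ = ℕ→ℚ 3

  c≤c[c+2] : ∀ {c} → 1ℚ ≤ c → c ≤ c * (c + 2ℚ)
  c≤c[c+2] {c} 1≤c = begin
    c             ≡⟨ *-identityʳ c ⟨
    c * 1ℚ        ≤⟨ mulˡ-≤ c 0≤c (≤-trans 1≤c (≤-from-gap 2ℚ (solve 2 (λ c t → c :+ t :- c := t) refl c 2ℚ) (ℕ→ℚ-nonNeg 2))) ⟩
    c * (c + 2ℚ)  ∎
    where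
    open ≤-Reasoning
    0≤c = ≤-trans (nonNegative⁻¹ 1ℚ) 1≤c

  -- For a scale c ≥ 1 with
  -- cε ≥ 3, a lag d with c ≤ αd ≤ c + 2 and n with αn ≥ c(c + 2), the two
  -- error terms α²n·d/(n + d) and (αn + 1)/d are at most α²n/c and 2α²n/c;
  -- cleared of denominators:
  --   (1 − ε) α²n (n + d) d ≤ α²n² d − (αn + 1)(n + d).
  asymptotic-polynomial : ∀ {α n d c ε} → 0ℚ < α → 0ℚ ≤ n → 0ℚ ≤ d → 1ℚ ≤ c → 3ℚ ≤ c * ε →
    c ≤ α * d → α * d ≤ c + 2ℚ → c * (c + 2ℚ) ≤ α * n →
    (1ℚ - ε) * (α * α * n) * ((n + d) * d) ≤ α * α * n * n * d - (α * n + 1ℚ) * (n + d)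
  asymptotic-polynomial {α} {n} {d} {c} {ε} 0<α 0≤n 0≤d 1≤c 3≤cε c≤αd αd≤c+2 c[c+2]≤αn =
    ≤-from-gap (ε * Y - Z) gap (gap-nonNeg Z≤εY)
    where
    open ≤-Reasoning
    0≤α = <⇒≤ 0<α
    0<c = <-≤-trans (positive⁻¹ 1ℚ) 1≤c
    0≤c = <⇒≤ 0<c
    0≤n+d = +-mono-≤ 0≤n 0≤d
    0≤α²n = *-nonNeg (*-nonNeg 0≤α 0≤α) 0≤n
    -- main term and error terms, all multiplied by (n + d) d
    Y = α * α * n * (n + d) * d
    Z = α * α * n * d * d + (α * n + 1ℚ) * (n + d)
    0≤Y : 0ℚ ≤ Y
    0≤Y = *-nonNeg (*-nonNeg 0≤α²n 0≤n+d) 0≤d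
    1≤αn : 1ℚ ≤ α * n
    1≤αn = ≤-trans 1≤c (≤-trans (c≤c[c+2] 1≤c) c[c+2]≤αn)
    cd≤n : c * d ≤ n
    cd≤n = cancel-mulˡ-≤ α 0<α (begin
      α * (c * d)   ≡⟨ solve 3 (λ α c d → α :* (c :* d) := c :* (α :* d)) refl α c d ⟩
      c * (α * d)   ≤⟨ mulˡ-≤ c 0≤c αd≤c+2 ⟩
      c * (c + 2ℚ)  ≤⟨ c[c+2]≤αn ⟩
      α * n         ∎)
    -- first error term: c · α²n d² ≤ α²n d (n + d), as cd ≤ n
    diagonal : c * (α * α * n * d * d) ≤ Y
    diagonal = begin
      c * (α * α * n * d * d)  ≡⟨ solve 5 (λ α n d c m → c :* (m :* d :* d) := m :* d :* (c :* d)) refl α n d c (α * α * n) ⟩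
      α * α * n * d * (c * d)  ≤⟨ mulˡ-≤ (α * α * n * d) (*-nonNeg 0≤α²n 0≤d) (≤-trans cd≤n (≤-from-gap d (solve 2 (λ n d → n :+ d :- n := d) refl n d) 0≤d)) ⟩
      α * α * n * d * (n + d)  ≡⟨ solve 3 (λ m n d → m :* d :* (n :+ d) := m :* (n :+ d) :* d) refl (α * α * n) n d ⟩
      Y                        ∎
    -- second error term: c (αn + 1)(n + d) ≤ 2αn (n + d) · αd = 2Y, as 1 ≤ αn, c ≤ αd
    boundary : c * ((α * n + 1ℚ) * (n + d)) ≤ 2ℚ * Y
    boundary = begin
      c * ((α * n + 1ℚ) * (n + d))     ≤⟨ mulˡ-≤ c 0≤c (mulʳ-≤ (n + d) 0≤n+d (+-monoʳ-≤ (α * n) 1≤αn)) ⟩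
      c * ((α * n + α * n) * (n + d))  ≡⟨ solve 4 (λ c α n d → c :* ((α :* n :+ α :* n) :* (n :+ d)) := (con 2ℚ :* α :* n :* (n :+ d)) :* c) refl c α n d ⟩
      (2ℚ * α * n * (n + d)) * c       ≤⟨ mulˡ-≤ (2ℚ * α * n * (n + d)) (*-nonNeg (*-nonNeg (*-nonNeg (ℕ→ℚ-nonNeg 2) 0≤α) 0≤n) 0≤n+d) c≤αd ⟩
      (2ℚ * α * n * (n + d)) * (α * d) ≡⟨ solve 4 (λ α n d t → t :* α :* n :* (n :+ d) :* (α :* d) := t :* (α :* α :* n :* (n :+ d) :* d)) refl α n d 2ℚ ⟩
      2ℚ * Y                           ∎
    Z≤εY : Z ≤ ε * Y
    Z≤εY = cancel-mulˡ-≤ c 0<c (begin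
      c * Z                    ≡⟨ *-distribˡ-+ c _ _ ⟩
      c * (α * α * n * d * d) + c * ((α * n + 1ℚ) * (n + d)) ≤⟨ +-mono-≤ diagonal boundary ⟩
      Y + 2ℚ * Y               ≡⟨ solve 1 (λ Y → Y :+ con 2ℚ :* Y := con 3ℚ :* Y) refl Y ⟩
      3ℚ * Y                   ≤⟨ mulʳ-≤ Y 0≤Y 3≤cε ⟩
      c * ε * Y                ≡⟨ *-assoc c ε Y ⟩
      c * (ε * Y)              ∎)
    gap : α * α * n * n * d - (α * n + 1ℚ) * (n + d) - (1ℚ - ε) * (α * α * n) * ((n + d) * d) ≡ ε * Y - Z
    gap = solve 4 (λ α n d ε → α :* α :* n :* n :* d :- (α :* n :+ con 1ℚ) :* (n :+ d) :- (con 1ℚ :- ε) :* (α :* α :* n) :* ((n :+ d) :* d)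
                              := ε :* (α :* α :* n :* (n :+ d) :* d) :- (α :* α :* n :* d :* d :+ (α :* n :+ con 1ℚ) :* (n :+ d))) refl α n d ε

  asymptotic-bound : ∀ {α c ε} N D₁ → 0ℚ < α → 1ℚ ≤ c → 3ℚ ≤ c * ε →
    c ≤ α * ℕ→ℚ (suc D₁) → α * ℕ→ℚ (suc D₁) ≤ c + 2ℚ → c * (c + 2ℚ) ≤ α * ℕ→ℚ N →
    (1ℚ - ε) * (α * α * ℕ→ℚ N) ≤ (α * α * ℕ→ℚ N * ℕ→ℚ N) * recip (N ℕ.+ suc D₁) - (α * ℕ→ℚ N + 1ℚ) * recip (suc D₁)
  asymptotic-bound {α} {c} {ε} N D₁ 0<α 1≤c 3≤cε c≤αd αd≤c+2 c[c+2]≤αn = cancel-mulʳ-≤ ((n + d) * d) 0<[n+d]d (begin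
    (1ℚ - ε) * (α * α * n) * ((n + d) * d)           ≤⟨ asymptotic-polynomial 0<α (ℕ→ℚ-nonNeg N) (<⇒≤ 0<d) 1≤c 3≤cε c≤αd αd≤c+2 c[c+2]≤αn ⟩
    α * α * n * n * d - (α * n + 1ℚ) * (n + d)       ≡⟨ clear-denominators ⟨
    (α * α * n * n * rN - (α * n + 1ℚ) * rD) * ((n + d) * d) ∎)
    where
    open ≤-Reasoning
    n = ℕ→ℚ N
    d = ℕ→ℚ (suc D₁)
    rN = recip (N ℕ.+ suc D₁)
    rD = recip (suc D₁)
    0<d : 0ℚ < d
    0<d = ℕ→ℚ-pos D₁
    0<[n+d]d : 0ℚ < (n + d) * d
    0<[n+d]d = *-pos (+-mono-≤-< (ℕ→ℚ-nonNeg N) 0<d) 0<d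
    [n+d]*rN≡1 : (n + d) * rN ≡ 1ℚ
    [n+d]*rN≡1 = begin-equality
      (n + d) * rN                                  ≡⟨ cong (_* rN) (ℕ→ℚ-+ N (suc D₁)) ⟨
      ℕ→ℚ (N ℕ.+ suc D₁) * recip (N ℕ.+ suc D₁)     ≡⟨ cong (λ t → ℕ→ℚ t * recip t) (ℕP.+-suc N D₁) ⟩
      ℕ→ℚ (suc (N ℕ.+ D₁)) * recip (suc (N ℕ.+ D₁)) ≡⟨ ℕ→ℚ*recip (N ℕ.+ D₁) ⟩
      1ℚ                                            ∎
    clear-denominators : (α * α * n * n * rN - (α * n + 1ℚ) * rD) * ((n + d) * d) ≡ α * α * n * n * d - (α * n + 1ℚ) * (n + d)
    clear-denominators = begin-equality
      (α * α * n * n * rN - (α * n + 1ℚ) * rD) * ((n + d) * d)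
        ≡⟨ solve 5 (λ α n d rN rD → (α :* α :* n :* n :* rN :- (α :* n :+ con 1ℚ) :* rD) :* ((n :+ d) :* d)
             := α :* α :* n :* n :* d :* ((n :+ d) :* rN) :- (α :* n :+ con 1ℚ) :* (n :+ d) :* (d :* rD)) refl α n d rN rD ⟩
      α * α * n * n * d * ((n + d) * rN) - (α * n + 1ℚ) * (n + d) * (d * rD)
        ≡⟨ cong₂ (λ a b → α * α * n * n * d * a - (α * n + 1ℚ) * (n + d) * b) [n+d]*rN≡1 (ℕ→ℚ*recip D₁) ⟩
      α * α * n * n * d * 1ℚ - (α * n + 1ℚ) * (n + d) * 1ℚ
        ≡⟨ solve 3 (λ α n d → α :* α :* n :* n :* d :* con 1ℚ :- (α :* n :+ con 1ℚ) :* (n :+ d) :* con 1ℚ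
             := α :* α :* n :* n :* d :- (α :* n :+ con 1ℚ) :* (n :+ d)) refl α n d ⟩
      α * α * n * n * d - (α * n + 1ℚ) * (n + d) ∎

  -- A scale c ≥ 1 with cε ≥ 3: take c = 3 × (denominator of ε).
  choose-scale : ∀ ε → 0ℚ < ε → ∃[ c ] (1 ℕ.≤ c × 3ℚ ≤ ℕ→ℚ c * ε)
  choose-scale ε@(mkℚ +[1+ e ] g cop) _ = 3 ℕ.* suc g , s≤s z≤n , (begin
    3ℚ                           ≡⟨ *-identityʳ 3ℚ ⟨
    3ℚ * 1ℚ                      ≤⟨ mulˡ-≤ 3ℚ (ℕ→ℚ-nonNeg 3) (ℕ→ℚ-mono-≤ (s≤s (z≤n {e}))) ⟩
    3ℚ * ℕ→ℚ (suc e)             ≡⟨ cong (3ℚ *_) (times-denominator (suc e) g cop) ⟨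
    3ℚ * (ε * ℕ→ℚ (suc g))       ≡⟨ solve 3 (λ t e g → t :* (e :* g) := t :* g :* e) refl 3ℚ ε (ℕ→ℚ (suc g)) ⟩
    3ℚ * ℕ→ℚ (suc g) * ε         ≡⟨ cong (_* ε) (ℕ→ℚ-* 3 (suc g)) ⟨
    ℕ→ℚ (3 ℕ.* suc g) * ε        ∎)
    where open ≤-Reasoning
  choose-scale (mkℚ (+ 0)    _ _) 0<ε with positive 0<ε
  ... | ()
  choose-scale (mkℚ -[1+ _ ] _ _) 0<ε with positive 0<ε
  ... | ()

  -- For 0 < α ≤ 1 the multiples αm step by at most 1, so one lands in
  -- [c, c + 2] with m ≥ 2: for α = a/b take m = ⌊cb/a⌋ + 2.
  choose-lag : ∀ α → 0ℚ < α → α ≤ 1ℚ → (c : ℕ) →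
    ∃[ m ] (2 ℕ.≤ m × ℕ→ℚ c ≤ α * ℕ→ℚ m × α * ℕ→ℚ m ≤ ℕ→ℚ c + 2ℚ)
  choose-lag α@(mkℚ +[1+ a ] b cop) _ α≤1 c = m , ℕP.m≤n+m 2 q , c≤αm , αm≤c+2
    where
    A = suc a
    B = suc b
    q = (c ℕ.* B) / A
    m = q ℕ.+ 2
    division : c ℕ.* B ≡ (c ℕ.* B) % A ℕ.+ q ℕ.* A
    division = m≡m%n+[m/n]*n (c ℕ.* B) A
    cB≤mA : c ℕ.* B ℕ.≤ m ℕ.* A
    cB≤mA = begin
      c ℕ.* B                          ≡⟨ division ⟩
      (c ℕ.* B) % A ℕ.+ q ℕ.* A        ≤⟨ ℕP.+-monoˡ-≤ (q ℕ.* A) (ℕP.≤-trans (ℕP.<⇒≤ (m%n<n (c ℕ.* B) A)) (ℕP.m≤m+n A (A ℕ.+ 0))) ⟩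
      2 ℕ.* A ℕ.+ q ℕ.* A              ≡⟨ ℕP.+-comm (2 ℕ.* A) (q ℕ.* A) ⟩
      q ℕ.* A ℕ.+ 2 ℕ.* A              ≡⟨ ℕP.*-distribʳ-+ A q 2 ⟨
      m ℕ.* A                          ∎
      where open ℕP.≤-Reasoning
    mA≤cB+2A : m ℕ.* A ℕ.≤ c ℕ.* B ℕ.+ 2 ℕ.* A
    mA≤cB+2A = begin
      m ℕ.* A                          ≡⟨ ℕP.*-distribʳ-+ A q 2 ⟩
      q ℕ.* A ℕ.+ 2 ℕ.* A              ≤⟨ ℕP.+-monoˡ-≤ (2 ℕ.* A) (ℕP.m≤n+m (q ℕ.* A) ((c ℕ.* B) % A)) ⟩
      (c ℕ.* B) % A ℕ.+ q ℕ.* A ℕ.+ 2 ℕ.* A ≡⟨ cong (ℕ._+ 2 ℕ.* A) division ⟨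
      c ℕ.* B ℕ.+ 2 ℕ.* A              ∎
      where open ℕP.≤-Reasoning
    αB≡A : α * ℕ→ℚ B ≡ ℕ→ℚ A
    αB≡A = times-denominator A b cop
    αmB≡mA : α * ℕ→ℚ m * ℕ→ℚ B ≡ ℕ→ℚ (m ℕ.* A)
    αmB≡mA = begin-equality
      α * ℕ→ℚ m * ℕ→ℚ B    ≡⟨ solve 3 (λ x y z → x :* y :* z := y :* (x :* z)) refl α (ℕ→ℚ m) (ℕ→ℚ B) ⟩
      ℕ→ℚ m * (α * ℕ→ℚ B)  ≡⟨ cong (ℕ→ℚ m *_) αB≡A ⟩
      ℕ→ℚ m * ℕ→ℚ A        ≡⟨ ℕ→ℚ-* m A ⟨
      ℕ→ℚ (m ℕ.* A)        ∎
      where open ≤-Reasoning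
    c≤αm : ℕ→ℚ c ≤ α * ℕ→ℚ m
    c≤αm = cancel-mulʳ-≤ (ℕ→ℚ B) (ℕ→ℚ-pos b) (subst₂ _≤_ (ℕ→ℚ-* c B) (sym αmB≡mA) (ℕ→ℚ-mono-≤ cB≤mA))
    αm≤c+2α : α * ℕ→ℚ m ≤ ℕ→ℚ c + 2ℚ * α
    αm≤c+2α = cancel-mulʳ-≤ (ℕ→ℚ B) (ℕ→ℚ-pos b) (subst₂ _≤_ (sym αmB≡mA) cB+2A≡[c+2α]B (ℕ→ℚ-mono-≤ mA≤cB+2A))
      where
      cB+2A≡[c+2α]B : ℕ→ℚ (c ℕ.* B ℕ.+ 2 ℕ.* A) ≡ (ℕ→ℚ c + 2ℚ * α) * ℕ→ℚ B
      cB+2A≡[c+2α]B = begin-equality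
        ℕ→ℚ (c ℕ.* B ℕ.+ 2 ℕ.* A)            ≡⟨ trans (ℕ→ℚ-+ (c ℕ.* B) (2 ℕ.* A)) (cong₂ _+_ (ℕ→ℚ-* c B) (ℕ→ℚ-* 2 A)) ⟩
        ℕ→ℚ c * ℕ→ℚ B + 2ℚ * ℕ→ℚ A          ≡⟨ cong (λ t → ℕ→ℚ c * ℕ→ℚ B + 2ℚ * t) αB≡A ⟨
        ℕ→ℚ c * ℕ→ℚ B + 2ℚ * (α * ℕ→ℚ B)    ≡⟨ solve 4 (λ c B t α → c :* B :+ t :* (α :* B) := (c :+ t :* α) :* B) refl (ℕ→ℚ c) (ℕ→ℚ B) 2ℚ α ⟩
        (ℕ→ℚ c + 2ℚ * α) * ℕ→ℚ B            ∎
        where open ≤-Reasoning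
    αm≤c+2 : α * ℕ→ℚ m ≤ ℕ→ℚ c + 2ℚ
    αm≤c+2 = ≤-trans αm≤c+2α (+-monoʳ-≤ (ℕ→ℚ c) (≤-trans (mulˡ-≤ 2ℚ (ℕ→ℚ-nonNeg 2) α≤1) (≤-reflexive (*-identityʳ 2ℚ))))
  choose-lag (mkℚ (+ 0)    _ _) 0<α _ _ with positive 0<α
  ... | ()
  choose-lag (mkℚ -[1+ _ ] _ _) 0<α _ _ with positive 0<α
  ... | ()

  via-lag : ∀ {D N α ε} c D′ → 1 ℕ.≤ c → 3ℚ ≤ ℕ→ℚ c * ε → D ℕ.≤ N → 0ℚ < α → α < 1ℚ →
    ℕ→ℚ c * (ℕ→ℚ c + 2ℚ) ≤ ℕ→ℚ D * α → 1 ℕ.≤ D′ → D′ ℕ.≤ D →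
    ℕ→ℚ c ≤ α * ℕ→ℚ D′ → α * ℕ→ℚ D′ ≤ ℕ→ℚ c + 2ℚ →
    (1ℚ - ε) * (α * α * ℕ→ℚ N) ≤ ℕ→ℚ (f D N α)
  via-lag {D} {N} {α} {ε} c (suc D₁′) 1≤c 3≤cε D≤N 0<α α<1 K≤Dα _ D′≤D c≤αD′ αD′≤c+2 = begin
    (1ℚ - ε) * (α * α * ℕ→ℚ N)
      ≤⟨ asymptotic-bound N D₁′ 0<α (ℕ→ℚ-mono-≤ 1≤c) 3≤cε c≤αD′ αD′≤c+2 K≤αN ⟩
    (α * α * ℕ→ℚ N * ℕ→ℚ N) * recip (N ℕ.+ suc D₁′) - (α * ℕ→ℚ N + 1ℚ) * recip (suc D₁′)
      ≤⟨ main-inequality D₁′ N α (<⇒≤ 0<α) (<⇒≤ α<1) ⟩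
    ℕ→ℚ (f (suc D₁′) N α)
      ≤⟨ ℕ→ℚ-mono-≤ (f-mono N α D′≤D) ⟩
    ℕ→ℚ (f D N α) ∎
    where
    open ≤-Reasoning
    K≤αN : ℕ→ℚ c * (ℕ→ℚ c + 2ℚ) ≤ α * ℕ→ℚ N
    K≤αN = ≤-trans K≤Dα (≤-trans (≤-reflexive (*-comm (ℕ→ℚ D) α)) (mulˡ-≤ α (<⇒≤ 0<α) (ℕ→ℚ-mono-≤ D≤N)))

  -- At a fixed N, once Dα ≥ c(c + 2): either the lag m from choose-lag is
  -- ≤ D, or D ≤ m and D itself already has αD ∈ [c, c + 2].
  bound-at : ∀ {D N α ε} c → 1 ℕ.≤ c → 3ℚ ≤ ℕ→ℚ c * ε → 2 ℕ.≤ D → D ℕ.≤ N → 0ℚ < α → α < 1ℚ →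
    ℕ→ℚ c * (ℕ→ℚ c + 2ℚ) ≤ ℕ→ℚ D * α → (1ℚ - ε) * (α * α * ℕ→ℚ N) ≤ ℕ→ℚ (f D N α)
  bound-at {D} {N} {α} {ε} c 1≤c 3≤cε 2≤D D≤N 0<α α<1 K≤Dα = from-lag (choose-lag α 0<α (<⇒≤ α<1) c)
    where
    2≤⇒1≤ : ∀ {n} → 2 ℕ.≤ n → 1 ℕ.≤ n
    2≤⇒1≤ = ℕP.≤-trans (ℕP.n≤1+n 1)
    from-lag : ∃[ m ] (2 ℕ.≤ m × ℕ→ℚ c ≤ α * ℕ→ℚ m × α * ℕ→ℚ m ≤ ℕ→ℚ c + 2ℚ) →
               (1ℚ - ε) * (α * α * ℕ→ℚ N) ≤ ℕ→ℚ (f D N α)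
    from-lag (m , 2≤m , c≤αm , αm≤c+2) = [ lag-D , lag-m ]′ (ℕP.≤-total D m)
      where
      lag-D : D ℕ.≤ m → (1ℚ - ε) * (α * α * ℕ→ℚ N) ≤ ℕ→ℚ (f D N α)
      lag-D D≤m = via-lag {D} {N} {α} {ε} c D 1≤c 3≤cε D≤N 0<α α<1 K≤Dα (2≤⇒1≤ 2≤D) ℕP.≤-refl
        (≤-trans (c≤c[c+2] (ℕ→ℚ-mono-≤ 1≤c)) (≤-trans K≤Dα (≤-reflexive (*-comm (ℕ→ℚ D) α))))
        (≤-trans (mulˡ-≤ α (<⇒≤ 0<α) (ℕ→ℚ-mono-≤ D≤m)) αm≤c+2)
      lag-m : m ℕ.≤ D → (1ℚ - ε) * (α * α * ℕ→ℚ N) ≤ ℕ→ℚ (f D N α)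
      lag-m m≤D = via-lag {D} {N} {α} {ε} c m 1≤c 3≤cε D≤N 0<α α<1 K≤Dα (2≤⇒1≤ 2≤m) m≤D c≤αm αm≤c+2

  asymptotic-bound-eventually : (D : ℕ → ℕ) (α : ℕ → ℚ) →
    (∃[ N₁ ] ∀ N → N₁ ℕ.≤ N → 2 ℕ.≤ D N × D N ℕ.≤ N × 0ℚ < α N × α N < 1ℚ) →
    (∀ (K : ℚ) → ∃[ N₀ ] ∀ N → N₀ ℕ.≤ N → K ≤ ℕ→ℚ (D N) * α N) →
    ∀ (ε : ℚ) → 0ℚ < ε → ∃[ N₀ ] ∀ N → N₀ ℕ.≤ N →
      (1ℚ - ε) * (α N * α N * ℕ→ℚ N) ≤ ℕ→ℚ (f (D N) N (α N))
  asymptotic-bound-eventually D α (N₁ , in-range) Dα→∞ ε 0<ε =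
    let (c , 1≤c , 3≤cε) = choose-scale ε 0<ε
        (N₀ , Dα-large)  = Dα→∞ (ℕ→ℚ c * (ℕ→ℚ c + 2ℚ))
    in N₁ ℕ.⊔ N₀ , λ N N≥ →
      let (2≤D , D≤N , 0<α , α<1) = in-range N (ℕP.≤-trans (ℕP.m≤m⊔n N₁ N₀) N≥)
      in bound-at {D N} {N} {α N} {ε} c 1≤c 3≤cε 2≤D D≤N 0<α α<1 (Dα-large N (ℕP.≤-trans (ℕP.m≤n⊔m N₁ N₀) N≥))


open import Defs
open import Data.Nat as ℕ using (ℕ; _+_; _≤_)
open import Data.Rational using (ℚ; 0ℚ; 1ℚ; _*_; _-_; _<_) renaming (_≤_ to _≤ℚ_; _+_ to _+ℚ_)
open import Data.Rational.Properties using (<⇒≤)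
open import Data.Product using (_×_; ∃-syntax; _,_)
open DensityBound using (main-inequality)
open Asymptotics using (asymptotic-bound-eventually)

theorem3p1 : ((D N : ℕ) (α : ℚ) → 2 ≤ D → D ≤ N → 0ℚ < α → α < 1ℚ →
    (α * α * ℕ→ℚ N * ℕ→ℚ N) * recip (N + D) - (α * ℕ→ℚ N +ℚ 1ℚ) * recip D
    ≤ℚ ℕ→ℚ (f D N α))
    ×
    ((D : ℕ → ℕ) (α : ℕ → ℚ) →
    (∃[ N₁ ] ∀ N → N₁ ≤ N → 2 ≤ D N × D N ≤ N × 0ℚ < α N × α N < 1ℚ) →
    (∀ (K : ℚ) → ∃[ N₀ ] ∀ N → N₀ ≤ N → K ≤ℚ ℕ→ℚ (D N) * α N) →
    ∀ (ε : ℚ) → 0ℚ < ε → ∃[ N₀ ] ∀ N → N₀ ≤ N →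
    (1ℚ - ε) * (α N * α N * ℕ→ℚ N) ≤ℚ ℕ→ℚ (f (D N) N (α N)))
theorem3p1 = main , asymptotic-bound-eventually
  where
  main : (D N : ℕ) (α : ℚ) → 2 ≤ D → D ≤ N → 0ℚ < α → α < 1ℚ →
    (α * α * ℕ→ℚ N * ℕ→ℚ N) * recip (N + D) - (α * ℕ→ℚ N +ℚ 1ℚ) * recip D ≤ℚ ℕ→ℚ (f D N α)
  main (ℕ.suc D₁) N α (ℕ.s≤s _) _ 0<α α<1 = main-inequality D₁ N α (<⇒≤ 0<α) (<⇒≤ α<1)
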